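{- Let $j\geq m\geq 2$ and $n\geq 2$ be integers. Then \[ \Big\lfloor \frac{n-1}{\lceil \frac{j}{m-1}\rceil-1}\Big\rfloor+1\leq m_j(K_m,K_{1,n})\leq \Big\lfloor \frac{n-1}{\frac{j}{m-1}-1}\Big\rfloor+1 . \]
   Context: All graphs are simple; $K_m$ is the complete graph on $m$ vertices and $K_{1,n}$ is the star with $n+1$ vertices ($n$ leaves). For integers $j\geq 2$ and $t\geq 1$, $K_{j\times t}$ denotes the complete multipartite graph with $j$ parts, each of size $t$. For graphs $H$ and $G$, the size multipartite Ramsey number $m_j(H,G)$ is the smallest natural number $t$ such that every coloring of the edges of $K_{j\times t}$ with two colors red and blue contains a red copy of $H$ or a blue copy of $G$ as a subgraph. -}

module Defs where

open import Data.Nat using (ℕ; zero; suc; _+_; _*_; _∸_; _<_; _≤_)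
open import Data.Nat.DivMod using (_/_)
open import Data.Fin using (Fin)
open import Data.Bool using (Bool; true; false)
open import Data.Product using (_×_; Σ; proj₁; ∃-syntax; _,_)
open import Data.Sum using (_⊎_)
open import Relation.Binary.PropositionalEquality using (_≡_; _≢_)
open import Relation.Nullary using (¬_)
open import Function.Definitions using (Injective)

-- Vertices of the complete multipartite graph K_{j×t}: (part, index in part).
Vertex : ℕ → ℕ → Set
Vertex j t = Fin j × Fin t

Adj : {j t : ℕ} → Vertex j t → Vertex j t → Set
Adj u v = proj₁ u ≢ proj₁ v

data Colour : Set where
  red blue : Colour

-- A 2-colouring of the edges of K_{j×t}: a symmetric colour assignment
-- to (unordered) pairs of adjacent vertices.
record Colouring (j t : ℕ) : Set where
  field
    col : Vertex j t → Vertex j t → Colour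
    sym : ∀ u v → Adj u v → col u v ≡ col v u
open Colouring public

RedClique : {j t : ℕ} → Colouring j t → ℕ → Set
RedClique {j} {t} c m =
  Σ (Fin m → Vertex j t) λ f →
    Injective _≡_ _≡_ f ×
    (∀ a b → a ≢ b → Adj (f a) (f b) × col c (f a) (f b) ≡ red)

-- A blue copy of K_{1,n}: a centre v and n distinct leaves, each joined to v
-- by a blue edge (adjacency forces leaves ≠ centre).
BlueStar : {j t : ℕ} → Colouring j t → ℕ → Set
BlueStar {j} {t} c n =
  Σ (Vertex j t) λ v → Σ (Fin n → Vertex j t) λ g →
    Injective _≡_ _≡_ g ×
    (∀ a → Adj v (g a) × col c v (g a) ≡ blue)

Arrows : ℕ → ℕ → ℕ → ℕ → Set
Arrows j t m n = (c : Colouring j t) → RedClique c m ⊎ BlueStar c n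

IsSizeRamsey : ℕ → ℕ → ℕ → ℕ → Set
IsSizeRamsey j m n t = Arrows j t m n × (∀ s → s < t → ¬ Arrows j s m n)

-- Floor division, total (returns 0 on divisor 0; never used with divisor 0).
divℕ : ℕ → ℕ → ℕ
divℕ a zero = 0
divℕ a (suc b) = a / suc b

ceilDiv : ℕ → ℕ → ℕ
ceilDiv a b = divℕ (a + b ∸ 1) b

lowerBound : ℕ → ℕ → ℕ → ℕ
lowerBound j m n = divℕ (n ∸ 1) (ceilDiv j (m ∸ 1) ∸ 1) + 1

-- ⌊(n-1) / (j/(m-1) - 1)⌋ + 1 = ⌊(n-1)(m-1) / (j-(m-1))⌋ + 1
upperBound : ℕ → ℕ → ℕ → ℕ
upperBound j m n = divℕ ((n ∸ 1) * (m ∸ 1)) (j ∸ (m ∸ 1)) + 1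

-- Write M = m - 1 and n′ = n - 1.
--
-- Upper bound: if a colouring of K_{j×t} has no blue K_{1,n}, every vertex has at
-- most n′ blue neighbours, so a vertex of a red clique rules out at most t + n′
-- candidates for extending it (its own part and its blue neighbourhood).  Hence as
-- long as M (t + n′) < j t a red clique can be grown greedily to m vertices, and
-- t = ⌊n′M / (j - M)⌋ + 1 satisfies this inequality.
--
-- Lower bound: with C = ⌈j / M⌉, the j parts fit into M blocks of at most C parts;
-- colour an edge blue inside a block and red across blocks.  A red clique meets
-- every block at most once, so has at most M vertices, and a blue star lies inside
-- one block and avoids the part of its centre, so has at most (C - 1) t leaves,
-- which is less than n whenever t ≤ ⌊n′ / (C - 1)⌋.
--
-- Everything is finite, so whether K_{j×t} arrows (K_m, K_{1,n}) is decidable, and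
-- m_j(K_m, K_{1,n}) is found as the least such t below the upper bound.

module Submission where

open import Defs renaming (sym to col-sym)
open import Data.Nat using (ℕ; zero; suc; _+_; _*_; _∸_; _^_; _<_; _≤_; z≤n; s≤s)
open import Data.Nat.Properties
  using (n≮n; <⇒≤; <⇒≱; ≮⇒≥; <-trans; ≤-refl; ≤-trans; ≤-reflexive; ≤-<-trans; m≤n⇒m≤1+n; m<1+n⇒m≤n;
         +-comm; +-suc; +-monoˡ-≤; +-monoˡ-<; +-monoʳ-<; +-cancelʳ-≤; *-comm; *-suc; *-monoˡ-≤; *-monoʳ-≤;
         *-distribˡ-+; *-distribʳ-+; m<n⇒0<n∸m; m+[n∸m]≡n; module ≤-Reasoning)
open import Data.Nat.DivMod using (_/_; _%_; m≡m%n+[m/n]*n; m%n<n; m/n*n≤m)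
open import Data.Fin
  using (Fin; zero; suc; toℕ; fromℕ; fromℕ<; inject≤; combine; punchOut; join; splitAt; funToFin; finToFun)
  renaming (_≟_ to _≟ᶠ_)
open import Data.Fin.Properties
  using (any?; all?; ¬∀⟶∃¬; ¬∀⟶∃¬-smallest; injective⇒≤; *↔×; combine-injective; punchOut-injective;
         inject≤-injective; suc-injective; finToFun-funToFin; splitAt-join;
         toℕ≤pred[n]; toℕ-fromℕ; toℕ-fromℕ<; toℕ-inject)
open import Data.Vec.Functional using (_∷_)
open import Data.Product using (_×_; Σ; ∃; ∃-syntax; _,_; proj₁; proj₂; uncurry; map₂)
open import Data.Product.Function.NonDependent.Propositional using (_×-↔_)
open import Data.Sum using (_⊎_; inj₁; inj₂)
import Data.Sum as Sum
open import Data.Sum.Properties using (inj₁-injective; inj₂-injective)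
open import Function using (_∘_; _↔_; _↣_; Inverse; Injection; mk↔ₛ′; mk↣)
open import Function.Definitions using (Injective)
open import Function.Properties.Inverse using (↔-refl; ↔-trans; ↔⇒↣)
open import Function.Properties.Injection using (↣-trans)
open import Level using (Level)
open import Relation.Binary.PropositionalEquality
  using (_≡_; _≢_; _≗_; refl; sym; trans; cong; cong₂; subst; subst₂; module ≡-Reasoning)
open import Relation.Nullary using (¬_; Dec; yes; no; contradiction)
open import Relation.Nullary.Decidable using (map′; ¬?; _×-dec_; _⊎-dec_; _→-dec_; decidable-stable)
open import Relation.Unary using (Pred; Decidable; _∪_)

private
  variable
    ℓ : Level
    A B : Set

-- Search over finite types

module _ {N : ℕ} (enum : Fin N ↔ A) where
  open Inverse enum

  ∃-finite? : {P : Pred A ℓ} → Decidable P → Dec (∃ P)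
  ∃-finite? {P = P} P? = map′ (λ (i , p) → to i , p)
    (λ (x , p) → from x , subst P (sym (strictlyInverseˡ x)) p)
    (any? (P? ∘ to))

  ∀-finite? : {P : Pred A ℓ} → Decidable P → Dec (∀ x → P x)
  ∀-finite? {P = P} P? = map′ (λ all x → subst P (strictlyInverseˡ x) (all (from x)))
    (λ all → all ∘ to)
    (all? (P? ∘ to))

Extensional : Pred (A → B) ℓ → Set ℓ
Extensional P = ∀ {f g} → f ≗ g → P f → P g

module _ {a b : ℕ} (enumA : Fin a ↔ A) (enumB : Fin b ↔ B) where
  private
    module EA = Inverse enumA
    module EB = Inverse enumB

    decode : Fin (b ^ a) → A → B
    decode k = EB.to ∘ finToFun k ∘ EA.from

    encode : (A → B) → Fin (b ^ a)
    encode f = funToFin (EB.from ∘ f ∘ EA.to)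

    decode-encode : ∀ f → decode (encode f) ≗ f
    decode-encode f x = begin
      EB.to (finToFun (encode f) (EA.from x))  ≡⟨ cong EB.to (finToFun-funToFin (EB.from ∘ f ∘ EA.to) (EA.from x)) ⟩
      EB.to (EB.from (f (EA.to (EA.from x))))  ≡⟨ EB.strictlyInverseˡ _ ⟩
      f (EA.to (EA.from x))                    ≡⟨ cong f (EA.strictlyInverseˡ x) ⟩
      f x                                      ∎
      where open ≡-Reasoning

  ∃-function? : {P : Pred (A → B) ℓ} → Extensional P → Decidable P → Dec (∃ P)
  ∃-function? resp P? = map′ (λ (k , p) → decode k , p)
    (λ (f , p) → encode f , resp (sym ∘ decode-encode f) p)
    (any? (P? ∘ decode))

  ∀-function? : {P : Pred (A → B) ℓ} → Extensional P → Decidable P → Dec (∀ f → P f)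
  ∀-function? {P = P} resp P? with ∃-function? {P = ¬_ ∘ P} (λ f≗g ¬pf → ¬pf ∘ resp (sym ∘ f≗g)) (¬? ∘ P?)
  ... | yes (f , ¬pf) = no λ all → ¬pf (all f)
  ... | no ∄¬p = yes λ f → decidable-stable (P? f) (λ ¬pf → ∄¬p (f , ¬pf))

-- Counting by injections

AtMost : ℕ → Pred A ℓ → Set ℓ
AtMost {A = A} n P = Σ (∀ x → P x → Fin n) λ r → ∀ {x y} (p : P x) (q : P y) → r x p ≡ r y q → x ≡ y

AtLeast : ℕ → Pred A ℓ → Set ℓ
AtLeast {A = A} n P = Σ (Fin n → A) λ g → Injective _≡_ _≡_ g × (∀ i → P (g i))

atLeast-0 : {P : Pred A ℓ} → AtLeast 0 P
atLeast-0 = (λ ()) , (λ { {()} }) , λ ()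

atMost⇒¬atLeast : ∀ {n} {P : Pred A ℓ} → AtMost n P → ¬ AtLeast (suc n) P
atMost⇒¬atLeast (r , r-inj) (g , g-inj , g∈P) =
  n≮n _ (injective⇒≤ {f = λ i → r (g i) (g∈P i)} (g-inj ∘ r-inj (g∈P _) (g∈P _)))

atMost-∪ : ∀ {a b} {P Q : Pred A ℓ} → AtMost a P → AtMost b Q → AtMost (a + b) (P ∪ Q)
atMost-∪ {a = a} {b} {P} {Q} (r , r-inj) (r′ , r′-inj) =
  (λ x p → join a b (tag x p)) , λ p q → tag-inj {p = p} {q} ∘ join-injective
  where
  tag : ∀ x → (P ∪ Q) x → Fin a ⊎ Fin b
  tag x (inj₁ p) = inj₁ (r x p)
  tag x (inj₂ q) = inj₂ (r′ x q)
  join-injective : ∀ {u v} → join a b u ≡ join a b v → u ≡ v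
  join-injective {u} {v} e = trans (sym (splitAt-join a b u)) (trans (cong (splitAt a) e) (splitAt-join a b v))
  tag-inj : ∀ {x y} {p : (P ∪ Q) x} {q : (P ∪ Q) y} → tag x p ≡ tag y q → x ≡ y
  tag-inj {p = inj₁ p} {inj₁ q} e = r-inj p q (inj₁-injective e)
  tag-inj {p = inj₂ p} {inj₂ q} e = r′-inj p q (inj₂-injective e)

atMost-⋃ : ∀ {k b} {P : Fin k → Pred A ℓ} → (∀ i → AtMost b (P i)) → AtMost (k * b) (λ x → ∃ λ i → P i x)
atMost-⋃ {k = k} {b} {P} bound = rank , rank-inj
  where
  rank : ∀ x → (∃ λ i → P i x) → Fin (k * b)
  rank x (i , p) = combine i (proj₁ (bound i) x p)
  rank-inj : ∀ {x y} (p : ∃ λ i → P i x) (q : ∃ λ i → P i y) → rank x p ≡ rank y q → x ≡ y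
  rank-inj (i , p) (i′ , q) e with combine-injective i _ i′ _ e
  ... | refl , e′ = proj₂ (bound i) p q e′

module _ {N : ℕ} (P : Pred (Fin (suc N)) ℓ) where

  atMost-suc⁺ : ∀ {n} → ¬ P zero → AtMost n (P ∘ suc) → AtMost n P
  atMost-suc⁺ {n} ¬p0 (r , r-inj) = r′ , r′-inj
    where
    r′ : ∀ x → P x → Fin n
    r′ zero p = contradiction p ¬p0
    r′ (suc x) p = r x p
    r′-inj : ∀ {x y} (p : P x) (q : P y) → r′ x p ≡ r′ y q → x ≡ y
    r′-inj {zero} p _ _ = contradiction p ¬p0
    r′-inj {suc _} {zero} _ q _ = contradiction q ¬p0
    r′-inj {suc _} {suc _} p q e = cong suc (r-inj p q e)

  atMost-∷⁺ : ∀ {n} → AtMost n (P ∘ suc) → AtMost (suc n) P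
  atMost-∷⁺ {n} (r , r-inj) = r′ , r′-inj
    where
    r′ : ∀ x → P x → Fin (suc n)
    r′ zero _ = zero
    r′ (suc x) p = suc (r x p)
    r′-inj : ∀ {x y} (p : P x) (q : P y) → r′ x p ≡ r′ y q → x ≡ y
    r′-inj {zero} {zero} _ _ _ = refl
    r′-inj {suc _} {suc _} p q e = cong suc (r-inj p q (suc-injective e))

  atLeast-suc⁺ : ∀ {n} → AtLeast n (P ∘ suc) → AtLeast n P
  atLeast-suc⁺ (g , g-inj , g∈P) = suc ∘ g , g-inj ∘ suc-injective , g∈P

  atLeast-∷⁺ : ∀ {n} → P zero → AtLeast n (P ∘ suc) → AtLeast (suc n) P
  atLeast-∷⁺ p0 (g , g-inj , g∈P) = (zero ∷ suc ∘ g) , inj , λ { zero → p0 ; (suc i) → g∈P i }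
    where
    inj : Injective _≡_ _≡_ (zero ∷ suc ∘ g)
    inj {zero} {zero} _ = refl
    inj {suc _} {suc _} e = cong suc (g-inj (suc-injective e))

atMost⊎atLeast : ∀ {N} {P : Pred (Fin N) ℓ} → Decidable P → ∀ n → AtMost n P ⊎ AtLeast (suc n) P
atMost⊎atLeast {N = zero} _ _ = inj₁ ((λ ()) , λ { {()} })
atMost⊎atLeast {N = suc N} {P = P} P? n with P? zero | n
... | no ¬p0 | n = Sum.map (atMost-suc⁺ P ¬p0) (atLeast-suc⁺ P) (atMost⊎atLeast (P? ∘ suc) n)
... | yes p0 | zero = inj₂ (atLeast-∷⁺ P p0 (atLeast-0 {P = P ∘ suc}))
... | yes p0 | suc n′ = Sum.map (atMost-∷⁺ P) (atLeast-∷⁺ P p0) (atMost⊎atLeast (P? ∘ suc) n′)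

module _ {N : ℕ} (enum : Fin N ↔ A) where
  open Inverse enum

  private
    from-injective : Injective _≡_ _≡_ from
    from-injective {x} {y} e = trans (sym (strictlyInverseˡ x)) (trans (cong to e) (strictlyInverseˡ y))

    to-injective : Injective _≡_ _≡_ to
    to-injective {i} {k} e = trans (sym (strictlyInverseʳ i)) (trans (cong from e) (strictlyInverseʳ k))

  atMost⊎atLeast-finite : {P : Pred A ℓ} → Decidable P → ∀ n → AtMost n P ⊎ AtLeast (suc n) P
  atMost⊎atLeast-finite {P = P} P? n = Sum.map pull push (atMost⊎atLeast (P? ∘ to) n)
    where
    pull : AtMost n (P ∘ to) → AtMost n P
    pull (r , r-inj) = (λ x p → r (from x) (subst P (sym (strictlyInverseˡ x)) p))
                     , λ p q → from-injective ∘ r-inj _ _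
    push : AtLeast (suc n) (P ∘ to) → AtLeast (suc n) P
    push (g , g-inj , g∈P) = to ∘ g , g-inj ∘ to-injective , g∈P

  atLeast? : {P : Pred A ℓ} → Decidable P → ∀ n → Dec (AtLeast n P)
  atLeast? {P = P} P? zero = yes (atLeast-0 {P = P})
  atLeast? P? (suc n) with atMost⊎atLeast-finite P? n
  ... | inj₁ atMost = no (atMost⇒¬atLeast atMost)
  ... | inj₂ atLeast = yes atLeast

  atMost-all⇒≤ : ∀ {n} {P : Pred A ℓ} → AtMost n P → (∀ x → P x) → N ≤ n
  atMost-all⇒≤ (r , r-inj) all = injective⇒≤ {f = λ i → r (to i) (all (to i))} (to-injective ∘ r-inj _ _)

-- Colourings and decidability of arrowing

private
  variable
    j t m n : ℕ

vertices : Fin (j * t) ↔ Vertex j t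
vertices = *↔×

colours : Fin 2 ↔ Colour
colours = mk↔ₛ′ (λ { zero → red ; (suc zero) → blue }) (λ { red → zero ; blue → suc zero })
  (λ { red → refl ; blue → refl }) (λ { zero → refl ; (suc zero) → refl })

_≟ᶜ_ : (x y : Colour) → Dec (x ≡ y)
red ≟ᶜ red = yes refl
red ≟ᶜ blue = no λ ()
blue ≟ᶜ red = no λ ()
blue ≟ᶜ blue = yes refl

adj? : (u v : Vertex j t) → Dec (Adj u v)
adj? u v = ¬? (proj₁ u ≟ᶠ proj₁ v)

module _ (c : Colouring j t) where

  RedEdge BlueEdge : Vertex j t → Vertex j t → Set
  RedEdge u v = Adj u v × col c u v ≡ red
  BlueEdge u v = Adj u v × col c u v ≡ blue

  IsRedClique : (Fin m → Vertex j t) → Set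
  IsRedClique f = ∀ a b → a ≢ b → RedEdge (f a) (f b)

  redEdge? : (u v : Vertex j t) → Dec (RedEdge u v)
  redEdge? u v = adj? u v ×-dec (col c u v ≟ᶜ red)

  blueEdge? : (u v : Vertex j t) → Dec (BlueEdge u v)
  blueEdge? u v = adj? u v ×-dec (col c u v ≟ᶜ blue)

  redEdge-sym : ∀ {u v} → RedEdge u v → RedEdge v u
  redEdge-sym (adj , isRed) = adj ∘ sym , trans (sym (col-sym c _ _ adj)) isRed

  redClique-injective : {f : Fin m → Vertex j t} → IsRedClique f → Injective _≡_ _≡_ f
  redClique-injective clique {a} {b} fa≡fb =
    decidable-stable (a ≟ᶠ b) λ a≢b → proj₁ (clique a b a≢b) (cong proj₁ fa≡fb)

  isRedClique? : (f : Fin m → Vertex j t) → Dec (IsRedClique f)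
  isRedClique? f = all? λ a → all? λ b → ¬? (a ≟ᶠ b) →-dec redEdge? (f a) (f b)

  redClique? : ∀ m → Dec (RedClique c m)
  redClique? m = map′ (λ (f , clique) → f , redClique-injective clique , clique)
                      (λ (f , _ , clique) → f , clique)
                      (∃-function? ↔-refl vertices isRedClique-resp isRedClique?)
    where
    isRedClique-resp : Extensional IsRedClique
    isRedClique-resp f≗g clique a b a≢b = subst₂ RedEdge (f≗g a) (f≗g b) (clique a b a≢b)

  blueStar? : ∀ n → Dec (BlueStar c n)
  blueStar? n = ∃-finite? vertices λ v → atLeast? vertices (blueEdge? v) n

redClique⊎blueStar-resp : (c c′ : Colouring j t) → (∀ u v → col c u v ≡ col c′ u v) →
                          RedClique c m ⊎ BlueStar c n → RedClique c′ m ⊎ BlueStar c′ n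
redClique⊎blueStar-resp c c′ c≗c′ = Sum.map
  (λ (f , f-inj , clique) → f , f-inj , λ a b a≢b → recolour (clique a b a≢b))
  (λ (v , g , g-inj , star) → v , g , g-inj , recolour ∘ star)
  where
  recolour : ∀ {u v x} → Adj u v × col c u v ≡ x → Adj u v × col c′ u v ≡ x
  recolour = map₂ (trans (sym (c≗c′ _ _)))

SymmetricColours : (Vertex j t × Vertex j t → Colour) → Set
SymmetricColours h = ∀ u v → Adj u v → h (u , v) ≡ h (v , u)

colouringFrom : (h : Vertex j t × Vertex j t → Colour) → SymmetricColours h → Colouring j t
col (colouringFrom h _) u v = h (u , v)
col-sym (colouringFrom _ symmetric) = symmetric

arrows? : ∀ j t m n → Dec (Arrows j t m n)
arrows? j t m n = map′ (λ all c → all (uncurry (col c)) (col-sym c)) (λ arrows h → arrows ∘ colouringFrom h)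
                       (∀-function? (↔-trans vertices (vertices ×-↔ vertices)) colours arrowsFrom-resp arrowsFrom?)
  where
  ArrowsFrom : (Vertex j t × Vertex j t → Colour) → Set
  ArrowsFrom h = (symmetric : SymmetricColours h) →
                 RedClique (colouringFrom h symmetric) m ⊎ BlueStar (colouringFrom h symmetric) n

  arrowsFrom-resp : Extensional ArrowsFrom
  arrowsFrom-resp {h} {h′} h≗h′ arrows symmetric′ =
    redClique⊎blueStar-resp (colouringFrom h symmetric) (colouringFrom h′ symmetric′)
                            (λ u v → h≗h′ (u , v)) (arrows symmetric)
    where
    symmetric : SymmetricColours h
    symmetric u v adj = trans (h≗h′ _) (trans (symmetric′ u v adj) (sym (h≗h′ _)))

  arrowsFrom? : ∀ h → Dec (ArrowsFrom h)
  arrowsFrom? h with ∀-finite? vertices (λ u → ∀-finite? vertices λ v → adj? u v →-dec (h (u , v) ≟ᶜ h (v , u)))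
  ... | no asymmetric = yes λ symmetric → contradiction symmetric asymmetric
  ... | yes symmetric = map′ (λ arrows _ → arrows) (λ arrows → arrows symmetric)
    (redClique? (colouringFrom h symmetric) m ⊎-dec blueStar? (colouringFrom h symmetric) n)

-- Upper bound: the greedy red clique

colour≢red⇒blue : ∀ {x} → x ≢ red → x ≡ blue
colour≢red⇒blue {red} x≢red = contradiction refl x≢red
colour≢red⇒blue {blue} _ = refl

SamePart : Vertex j t → Vertex j t → Set
SamePart v u = proj₁ v ≡ proj₁ u

atMost-samePart : (v : Vertex j t) → AtMost t (SamePart v)
atMost-samePart v = (λ u _ → proj₂ u) , λ p q → cong₂ _,_ (trans (sym p) q)

module _ (c : Colouring j t) {n′ : ℕ} (noStar : ¬ BlueStar c (suc n′)) where

  atMost-blueEdge : ∀ v → AtMost n′ (BlueEdge c v)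
  atMost-blueEdge v with atMost⊎atLeast-finite vertices (blueEdge? c v) n′
  ... | inj₁ atMost = atMost
  ... | inj₂ star = contradiction (v , star) noStar

  ¬redEdge⇒samePart⊎blueEdge : ∀ {v u} → ¬ RedEdge c v u → (SamePart v ∪ BlueEdge c v) u
  ¬redEdge⇒samePart⊎blueEdge {v} {u} ¬red with proj₁ v ≟ᶠ proj₁ u
  ... | yes same = inj₁ same
  ... | no adj = inj₂ (adj , colour≢red⇒blue (λ isRed → ¬red (adj , isRed)))

  redExtension : ∀ {k} → k * (t + n′) < j * t → (f : Fin k → Vertex j t) → ∃ λ u → ∀ i → RedEdge c (f i) u
  redExtension {k} small f with ∃-finite? vertices (λ u → all? λ i → redEdge? c (f i) u)
  ... | yes extension = extension
  ... | no ∄extension = contradiction (atMost-all⇒≤ vertices (atMost-⋃ atMost-blocked) blocked) (<⇒≱ small)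
    where
    atMost-blocked : ∀ i → AtMost (t + n′) (SamePart (f i) ∪ BlueEdge c (f i))
    atMost-blocked i = atMost-∪ (atMost-samePart (f i)) (atMost-blueEdge (f i))
    blocked : ∀ u → ∃ λ i → (SamePart (f i) ∪ BlueEdge c (f i)) u
    blocked u = map₂ ¬redEdge⇒samePart⊎blueEdge
      (¬∀⟶∃¬ k _ (λ i → redEdge? c (f i) u) (λ extends → ∄extension (u , extends)))

  redClique-∷ : ∀ {k} {f : Fin k → Vertex j t} {u} →
                (∀ i → RedEdge c (f i) u) → IsRedClique c f → IsRedClique c (u ∷ f)
  redClique-∷ extends clique zero zero 0≢0 = contradiction refl 0≢0
  redClique-∷ extends clique zero (suc b) _ = redEdge-sym c (extends b)
  redClique-∷ extends clique (suc a) zero _ = extends a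
  redClique-∷ extends clique (suc a) (suc b) a≢b = clique a b (a≢b ∘ cong suc)

  greedyRedClique : ∀ {M} → M * (t + n′) < j * t → ∀ k → k ≤ suc M → Σ (Fin k → Vertex j t) (IsRedClique c)
  greedyRedClique small zero _ = (λ ()) , λ ()
  greedyRedClique small (suc k) (s≤s k≤M) =
    let (f , clique) = greedyRedClique small k (m≤n⇒m≤1+n k≤M)
        (u , extends) = redExtension (≤-<-trans (*-monoˡ-≤ _ k≤M) small) f
    in (u ∷ f) , redClique-∷ extends clique

M*[t+n]<j*t⇒arrows : ∀ {M n′} → M * (t + n′) < j * t → Arrows j t (suc M) (suc n′)
M*[t+n]<j*t⇒arrows {M = M} {n′} small c with blueStar? c (suc n′)
... | yes star = inj₂ star
... | no noStar =
  let (f , clique) = greedyRedClique c noStar small (suc M) ≤-refl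
  in inj₁ (f , redClique-injective c clique , clique)

-- Lower bound: the block colouring

blueIf : {P : Set} → Dec P → Colour
blueIf (yes _) = blue
blueIf (no _) = red

blueIf-blue : {P : Set} (d : Dec P) → blueIf d ≡ blue → P
blueIf-blue (yes p) _ = p

blueIf-red : {P : Set} (d : Dec P) → blueIf d ≡ red → ¬ P
blueIf-red (no ¬p) _ = ¬p

blueIf-cong : {P Q : Set} → (P → Q) → (Q → P) → (d : Dec P) (e : Dec Q) → blueIf d ≡ blueIf e
blueIf-cong _ _ (yes _) (yes _) = refl
blueIf-cong _ _ (no _) (no _) = refl
blueIf-cong P⇒Q _ (yes p) (no ¬q) = contradiction (P⇒Q p) ¬q
blueIf-cong _ Q⇒P (no ¬p) (yes q) = contradiction (Q⇒P q) ¬p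

module _ {j s c M : ℕ} (parts : Fin j ↣ (Fin (suc c) × Fin M)) where
  open Injection parts using (to; injective)

  slot : Vertex j s → Fin (suc c)
  slot u = proj₁ (to (proj₁ u))

  block : Vertex j s → Fin M
  block u = proj₂ (to (proj₁ u))

  blockColouring : Colouring j s
  col blockColouring u v = blueIf (block u ≟ᶠ block v)
  col-sym blockColouring u v _ = blueIf-cong sym sym (block u ≟ᶠ block v) (block v ≟ᶠ block u)

  samePart : ∀ {u w} → slot u ≡ slot w → block u ≡ block w → proj₁ u ≡ proj₁ w
  samePart slot≡ block≡ = injective (cong₂ _,_ slot≡ block≡)

  blockColouring-¬redClique : ¬ RedClique blockColouring (suc M)
  blockColouring-¬redClique (f , _ , clique) = n≮n M (injective⇒≤ {f = block ∘ f} block∘f-injective)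
    where
    block∘f-injective : Injective _≡_ _≡_ (block ∘ f)
    block∘f-injective {a} {b} block≡ = decidable-stable (a ≟ᶠ b) λ a≢b →
      blueIf-red (block (f a) ≟ᶠ block (f b)) (proj₂ (clique a b a≢b)) block≡

  blockColouring-¬blueStar : ∀ {n} → c * s < n → ¬ BlueStar blockColouring n
  blockColouring-¬blueStar {n} small (v , g , g-inj , star) =
    contradiction (injective⇒≤ leaf-injective) (<⇒≱ small)
    where
    sameBlock : ∀ a → block v ≡ block (g a)
    sameBlock a = blueIf-blue (block v ≟ᶠ block (g a)) (proj₂ (star a))
    otherSlot : ∀ a → slot v ≢ slot (g a)
    otherSlot a slot≡ = proj₁ (star a) (samePart {v} {g a} slot≡ (sameBlock a))
    leaf : Fin n → Fin (c * s)
    leaf a = combine (punchOut (otherSlot a)) (proj₂ (g a))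
    leaf-injective : Injective _≡_ _≡_ leaf
    leaf-injective {a} {b} leaf≡ =
      let (punched≡ , index≡) = combine-injective _ _ _ _ leaf≡
          slot≡ = punchOut-injective (otherSlot a) (otherSlot b) punched≡
      in g-inj (cong₂ _,_ (samePart {g a} {g b} slot≡ (trans (sym (sameBlock a)) (sameBlock b))) index≡)

  c*s<n⇒¬arrows : ∀ {n} → c * s < n → ¬ Arrows j s (suc M) n
  c*s<n⇒¬arrows small arrows with arrows blockColouring
  ... | inj₁ clique = blockColouring-¬redClique clique
  ... | inj₂ star = blockColouring-¬blueStar small star

parts↣blocks : ∀ {j C M} → j ≤ C * M → Fin j ↣ (Fin C × Fin M)
parts↣blocks j≤C*M = ↣-trans (mk↣ {to = λ p → inject≤ p j≤C*M} (inject≤-injective _ _ _ _)) (↔⇒↣ *↔×)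

-- Arithmetic of the bounds

m<n*[divℕ[m,n]+1] : ∀ m n → 0 < n → m < n * (divℕ m n + 1)
m<n*[divℕ[m,n]+1] m n@(suc d) _ = begin-strict
  m                  ≡⟨ m≡m%n+[m/n]*n m n ⟩
  m % n + q * n      <⟨ +-monoˡ-< (q * n) (m%n<n m n) ⟩
  n + q * n          ≡⟨ cong (n +_) (*-comm q n) ⟩
  n + n * q          ≡⟨ *-suc n q ⟨
  n * suc q          ≡⟨ cong (n *_) (+-comm 1 q) ⟩
  n * (q + 1)        ∎
  where
  open ≤-Reasoning
  q = m / n

m*divℕ[n,m]≤n : ∀ m n → m * divℕ n m ≤ n
m*divℕ[n,m]≤n zero _ = z≤n
m*divℕ[n,m]≤n m@(suc _) n = ≤-trans (≤-reflexive (*-comm m (n / m))) (m/n*n≤m n m)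

m≤ceilDiv[m,n]*n : ∀ m n → 0 < n → m ≤ ceilDiv m n * n
m≤ceilDiv[m,n]*n m n@(suc d) _ = +-cancelʳ-≤ d m (q * n) (begin
  m + d              ≡⟨ cong (_∸ 1) (+-suc m d) ⟨
  x                  ≡⟨ m≡m%n+[m/n]*n x n ⟩
  x % n + q * n      ≤⟨ +-monoˡ-≤ (q * n) (m<1+n⇒m≤n (m%n<n x n)) ⟩
  d + q * n          ≡⟨ +-comm d (q * n) ⟩
  q * n + d          ∎)
  where
  open ≤-Reasoning
  x = m + n ∸ 1
  q = x / n

least-witness : {P : Pred ℕ ℓ} → Decidable P → ∀ {u} → P u → ∃ λ t → t ≤ u × P t × (∀ s → s < t → ¬ P s)
least-witness {P = P} P? {u} pu with ¬∀⟶∃¬-smallest (suc u) (¬_ ∘ P ∘ toℕ) (¬? ∘ P? ∘ toℕ)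
                                       (λ none → none (fromℕ u) (subst P (sym (toℕ-fromℕ u)) pu))
... | t , ¬¬pt , below = toℕ t , toℕ≤pred[n] t , decidable-stable (P? (toℕ t)) ¬¬pt , λ s s<t →
  subst (¬_ ∘ P) (trans (toℕ-inject (fromℕ< s<t)) (toℕ-fromℕ< s<t)) (below (fromℕ< s<t))

M*[upperBound+n]<j*upperBound : ∀ {j M n′} → M < j →
                                let U = upperBound j (suc M) (suc n′) in M * (U + n′) < j * U
M*[upperBound+n]<j*upperBound {j} {M} {n′} M<j = begin-strict
  M * (U + n′)          ≡⟨ *-distribˡ-+ M U n′ ⟩
  M * U + M * n′        ≡⟨ cong (M * U +_) (*-comm M n′) ⟩
  M * U + n′ * M        <⟨ +-monoʳ-< (M * U) (m<n*[divℕ[m,n]+1] (n′ * M) (j ∸ M) (m<n⇒0<n∸m M<j)) ⟩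
  M * U + (j ∸ M) * U   ≡⟨ *-distribʳ-+ U M (j ∸ M) ⟨
  (M + (j ∸ M)) * U     ≡⟨ cong (_* U) (m+[n∸m]≡n (<⇒≤ M<j)) ⟩
  j * U                 ∎
  where
  open ≤-Reasoning
  U = upperBound j (suc M) (suc n′)

<lowerBound⇒¬arrows : ∀ {j M n′ s} → 0 < j → 0 < M →
                      s < lowerBound j (suc M) (suc n′) → ¬ Arrows j s (suc M) (suc n′)
<lowerBound⇒¬arrows {j} {M} {n′} {s} 0<j 0<M s<L = refute C (m≤ceilDiv[m,n]*n j M 0<M) (s≤s (begin
    (C ∸ 1) * s                      ≤⟨ *-monoʳ-≤ (C ∸ 1) (m<1+n⇒m≤n (subst (s <_) (+-comm q 1) s<L)) ⟩
    (C ∸ 1) * q                      ≤⟨ m*divℕ[n,m]≤n (C ∸ 1) n′ ⟩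
    n′                               ∎))
  where
  open ≤-Reasoning
  C = ceilDiv j M
  q = divℕ n′ (C ∸ 1)
  refute : ∀ k → j ≤ k * M → (k ∸ 1) * s < suc n′ → ¬ Arrows j s (suc M) (suc n′)
  refute zero j≤0 _ = contradiction j≤0 (<⇒≱ 0<j)
  refute (suc c) j≤k*M small = c*s<n⇒¬arrows (parts↣blocks {C = suc c} j≤k*M) small

theorem4 : (j m n : ℕ) → 2 ≤ m → m ≤ j → 2 ≤ n →
    ∃[ t ] (IsSizeRamsey j m n t × lowerBound j m n ≤ t × t ≤ upperBound j m n)
theorem4 j (suc M) (suc n′) (s≤s 0<M) M<j _ =
  let (t , t≤U , arrows , minimal) = least-witness (λ t → arrows? j t (suc M) (suc n′))
                                       (M*[t+n]<j*t⇒arrows (M*[upperBound+n]<j*upperBound M<j))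
  in t , (arrows , minimal) , ≮⇒≥ (λ t<L → <lowerBound⇒¬arrows (<-trans 0<M M<j) 0<M t<L arrows) , t≤U
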